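{- Let $\beta_\gamma$ be the Bundle Event Structure with events $\{a,b,c\}$, conflict $a\#b$ (and $b\#a$), and the single bundle $\{a,b\}\mapsto c$; its set of configurations is $\{\emptyset,\{a\},\{b\},\{a,c\},\{b,c\}\}$. There is no GES $\gamma$ with $\mathcal C(\gamma)=\mathcal C(\beta_\gamma)$.
   Context: A Bundle Event Structure (BES) is $(E,\#,\mapsto)$ with $\#\subseteq E^2$ irreflexive and symmetric and bundles $\mapsto\subseteq\mathcal P(E)\times E$ such that distinct members of a bundle are in conflict; a trace is a sequence $e_1\cdots e_n$ of pairwise distinct, pairwise non-conflicting events such that each bundle $X\mapsto e_i$ meets $\{e_1,\dots,e_{i-1}\}$; configurations are the event sets of traces. A Growing Causality Event Structure (GES) is $\gamma=(E,\to,\mathrm{Add})$ with $E$ a set of events, $\to\subseteq E^2$ the initial causality, and $\mathrm{Add}\subseteq E^3$ such that $(a,c,t)\in\mathrm{Add}$ implies $\neg(c\to t)$ and $a\notin\{c,t\}$ (the occurrence of $a$ adds $c$ as a cause of $t$). Let $\mathrm{ic}(e)=\{e'\mid e'\to e\}$ and $\mathrm{ac}(H,e)=\{e'\mid\exists a\in H.(a,e',e)\in\mathrm{Add}\}$. For $X,Y\subseteq E$, $X\mapsto_\gamma Y$ iff (1) $X\subsetneq Y$, (2) $\mathrm{ic}(e)\cup\mathrm{ac}(X,e)\subseteq X$ for all $e\in Y\setminus X$, and (3) for all $t,a\in Y\setminus X$ and $c\in E$, $(a,c,t)\in\mathrm{Add}$ implies $c\in X$. $\mathcal C(\gamma)$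 is the set of finite $X$ with $\emptyset\mapsto_\gamma^* X$. -}

module Defs where

open import Level using (0ℓ)
open import Data.Empty using (⊥)
open import Data.Product using (Σ; ∃; _×_; _,_)
open import Data.Sum using (_⊎_)
open import Data.Fin using (Fin; zero; suc)
open import Data.List using (List; []; _∷_)
open import Data.List.Membership.Propositional renaming (_∈_ to _∈ₗ_; _∉_ to _∉ₗ_)
open import Relation.Nullary using (¬_)
open import Relation.Binary.PropositionalEquality using (_≡_; _≢_)
open import Relation.Unary using (Pred; _∈_; _∉_; _⊆_; _≐_)
open import Relation.Binary.Construct.Closure.ReflexiveTransitive using (Star)

EvSet : Set → Set₁
EvSet E = Pred E 0ℓ

IsEmpty : {E : Set} → EvSet E → Set
IsEmpty X = ∀ e → e ∉ X

IsFinite : {E : Set} → EvSet E → Set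
IsFinite {E} X = Σ (List E) λ xs → ∀ e → (e ∈ X → e ∈ₗ xs) × (e ∈ₗ xs → e ∈ X)

record BES : Set₁ where
  field
    Ev      : Set
    _#_     : Ev → Ev → Set
    #-irrefl : ∀ e → ¬ (e # e)
    #-sym   : ∀ {e e'} → e # e' → e' # e
    Bundle  : EvSet Ev → Ev → Set
    bundle-conflict : ∀ {X e} → Bundle X e →
                      ∀ {x y} → x ∈ X → y ∈ X → x ≢ y → x # y

module _ (β : BES) where
  open BES β

  -- Traces, stored in REVERSE order: the head of the list is the last event.
  data IsTrace : List Ev → Set₁ where
    []  : IsTrace []
    ext : ∀ {es} e → IsTrace es →
          e ∉ₗ es →
          (∀ x → x ∈ₗ es → ¬ (x # e)) →
          (∀ X → Bundle X e → ∃ λ x → x ∈ₗ es × x ∈ X) →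
          IsTrace (e ∷ es)

  BConf : EvSet Ev → Set₁
  BConf X = Σ (List Ev) λ es → IsTrace es × (∀ e → (e ∈ X → e ∈ₗ es) × (e ∈ₗ es → e ∈ X))

evA evB evC : Fin 3
evA = zero
evB = suc zero
evC = suc (suc zero)

data _#βγ_ : Fin 3 → Fin 3 → Set where
  ab : evA #βγ evB
  ba : evB #βγ evA

BundleβΓ : EvSet (Fin 3) → Fin 3 → Set
BundleβΓ X e = (X ≐ (λ x → x ≡ evA ⊎ x ≡ evB)) × e ≡ evC

private
  irr : ∀ e → ¬ (e #βγ e)
  irr _ ()

  sym# : ∀ {e e'} → e #βγ e' → e' #βγ e
  sym# ab = ba
  sym# ba = ab

  open import Relation.Binary.PropositionalEquality using (refl)
  open import Data.Sum using (inj₁; inj₂)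
  open import Data.Empty using (⊥-elim)

  bc : ∀ {X e} → BundleβΓ X e → ∀ {x y} → x ∈ X → y ∈ X → x ≢ y → x #βγ y
  bc (sub , _) {x} {y} x∈ y∈ x≢y with Data.Product.proj₁ sub x∈ | Data.Product.proj₁ sub y∈
  ... | inj₁ refl | inj₁ refl = ⊥-elim (x≢y refl)
  ... | inj₁ refl | inj₂ refl = ab
  ... | inj₂ refl | inj₁ refl = ba
  ... | inj₂ refl | inj₂ refl = ⊥-elim (x≢y refl)

βγ : BES
βγ = record
  { Ev = Fin 3 ; _#_ = _#βγ_ ; #-irrefl = irr ; #-sym = sym#
  ; Bundle = BundleβΓ ; bundle-conflict = bc }

record GES : Set₁ where
  field
    Ev   : Set
    _⟶_  : Ev → Ev → Set
    -- Add a c t : occurrence of a adds c as a cause of t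
    Add  : Ev → Ev → Ev → Set
    Add-wf : ∀ {a c t} → Add a c t → ¬ (c ⟶ t) × a ≢ c × a ≢ t

module _ (γ : GES) where
  open GES γ

  ic : Ev → EvSet Ev
  ic e e' = e' ⟶ e

  ac : EvSet Ev → Ev → EvSet Ev
  ac H e e' = ∃ λ a → a ∈ H × Add a e' e

  Step : EvSet Ev → EvSet Ev → Set
  Step X Y =
    (X ⊆ Y × ¬ (Y ⊆ X)) ×
    (∀ e → e ∈ Y → e ∉ X → (ic e ⊆ X) × (ac X e ⊆ X)) ×
    (∀ t a c → t ∈ Y → t ∉ X → a ∈ Y → a ∉ X → Add a c t → c ∈ X)

  -- 𝒞(γ): finite X with ∅ ↦γ* X  (starting from any empty predicate, so
  -- that membership is invariant under extensional equality of sets)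
  GConf : EvSet Ev → Set₁
  GConf X = IsFinite X × (Σ (EvSet Ev) λ Z → IsEmpty Z × Star Step Z X)

image : {A B : Set} → (A → B) → EvSet A → EvSet B
image f Y b = ∃ λ i → i ∈ Y × f i ≡ b

-- A GES can never demand "one of a or b" before c: any cause of c that is
-- present in both configurations {a,c} and {b,c} must be common to both, so c has
-- no initial causes at all, and then {c} is reachable from ∅ in a single step.
-- In β_γ, however, c is always preceded by a or b, so {c} is not a configuration.
module Submission where

open import Defs
open import Data.Product using (Σ; ∃; _×_; _,_; proj₁; proj₂)
open import Data.Sum using (_⊎_; inj₁; inj₂)
open import Data.Empty using (⊥; ⊥-elim)
open import Data.Fin using (Fin)
open import Data.List using ([]; _∷_)
open import Data.List.Relation.Unary.Any using (here; there)
open import Data.List.Membership.Propositional using () renaming (_∈_ to _∈ₗ_)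
open import Function using (id; _∘_)
open import Function.Bundles using (_⇔_; Equivalence)
open import Function.Definitions using (Injective)
open import Relation.Nullary using (¬_)
open import Relation.Binary.PropositionalEquality using (_≡_; _≢_; refl; sym; trans)
open import Relation.Unary using (_≐_; _∈_; _∉_; _⊆_; ∅; ｛_｝; _∪_)
open import Relation.Binary.Construct.Closure.ReflexiveTransitive using (Star; ε; _◅_)

module _ (γ : GES) where
  open GES γ

  Star-Step-⊆ : ∀ {X Y} → Star (Step γ) X Y → X ⊆ Y
  Star-Step-⊆ ε        = id
  Star-Step-⊆ (s ◅ ss) = Star-Step-⊆ ss ∘ proj₁ (proj₁ s)

  -- The step at which t enters cannot be located constructively, hence ¬ ¬.
  Star-Step-cause : ∀ {X Y t e} → Star (Step γ) X Y → t ∉ X → t ∈ Y → e ⟶ t →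
                    ¬ ¬ (e ∈ Y × e ≢ t)
  Star-Step-cause ε t∉X t∈X _ _ = t∉X t∈X
  Star-Step-cause {X} {t = t} {e} (_◅_ {j = X′} s ss) t∉X t∈Y e⟶t k =
    Star-Step-cause ss t∉X′ t∈Y e⟶t k
    where
      t∉X′ : t ∉ X′
      t∉X′ t∈X′ = k (Star-Step-⊆ (s ◅ ss) e∈X , λ { refl → t∉X e∈X })
        where
          e∈X : e ∈ X
          e∈X = proj₁ (proj₁ (proj₂ s) t t∈X′ t∉X) e⟶t

  GConf-cause : ∀ {X t e} → GConf γ X → t ∈ X → e ⟶ t → ¬ ¬ (e ∈ X × e ≢ t)
  GConf-cause (_ , Z , Z-empty , run) t∈X = Star-Step-cause run (Z-empty _) t∈X

  GConf-｛｝ : ∀ {t} → (∀ e → ¬ e ⟶ t) → GConf γ ｛ t ｝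
  GConf-｛｝ {t} uncaused = finite , ∅ , (λ _ ()) , step ◅ ε
    where
      finite : IsFinite ｛ t ｝
      finite = t ∷ [] , λ _ → (λ { refl → here refl }) , (λ { (here refl) → refl })

      step : Step γ ∅ ｛ t ｝
      step = ((λ ()) , (λ ⊆∅ → ⊆∅ refl))
           , (λ { _ refl _ → (λ {e} → ⊥-elim ∘ uncaused e) , (λ { (_ , () , _) }) })
           , (λ { _ _ _ refl _ refl _ add → ⊥-elim (proj₂ (proj₂ (Add-wf add)) refl) })

module _ (β : BES) where
  open BES β

  trace-initial : ∀ {e es} → IsTrace β (e ∷ es) → ∃ λ x → x ∈ₗ e ∷ es × (∀ X → ¬ Bundle X x)
  trace-initial (ext e [] _ _ bundles) = e , here refl , λ X b → nothing-before (bundles X b)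
    where
      nothing-before : ∀ {X} → ¬ (∃ λ x → x ∈ₗ [] × x ∈ X)
      nothing-before (_ , () , _)
  trace-initial (ext _ tr@(ext _ _ _ _ _) _ _ _) =
    let x , x∈ , unbundled = trace-initial tr in x , there x∈ , unbundled

  BConf-initial : ∀ {Y x} → BConf β Y → x ∈ Y → ∃ λ y → y ∈ Y × (∀ X → ¬ Bundle X y)
  BConf-initial ([] , _ , Y≐es) x∈Y with () ← proj₁ (Y≐es _) x∈Y
  BConf-initial (_ ∷ _ , tr , Y≐es) _ =
    let y , y∈es , unbundled = trace-initial tr in y , proj₂ (Y≐es y) y∈es , unbundled

AB : EvSet (Fin 3)
AB x = x ≡ evA ⊎ x ≡ evB

AB-≢evC : ∀ {x} → x ∈ AB → x ≢ evC
AB-≢evC (inj₁ refl) ()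
AB-≢evC (inj₂ refl) ()

BConf-·c : ∀ {x} → x ∈ AB → BConf βγ (｛ x ｝ ∪ ｛ evC ｝)
BConf-·c {x} x∈AB = evC ∷ x ∷ [] , trace , members
  where
    x-#-free : ∀ y → y ∈ₗ x ∷ [] → ¬ (y #βγ evC)
    x-#-free _ (here refl) ()

    trace : IsTrace βγ (evC ∷ x ∷ [])
    trace = ext evC (ext x [] (λ ()) (λ _ ())
                  (λ { _ (_ , x≡evC) → ⊥-elim (AB-≢evC x∈AB x≡evC) }))
                (λ { (here evC≡x) → AB-≢evC x∈AB (sym evC≡x) })
                x-#-free
                (λ { _ (X≐AB , refl) → x , here refl , proj₂ X≐AB x∈AB })

    members : ∀ e → (e ∈ ｛ x ｝ ∪ ｛ evC ｝ → e ∈ₗ evC ∷ x ∷ []) × (e ∈ₗ evC ∷ x ∷ [] → e ∈ ｛ x ｝ ∪ ｛ evC ｝)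
    members _ = (λ { (inj₁ refl) → there (here refl) ; (inj₂ refl) → here refl })
              , (λ { (here refl) → inj₂ refl ; (there (here refl)) → inj₁ refl })

evC-only-not-BConf : ∀ {Y} → BConf βγ Y → evC ∈ Y → Y ⊆ ｛ evC ｝ → ⊥
evC-only-not-BConf conf evC∈Y Y⊆c with BConf-initial βγ conf evC∈Y
... | y , y∈Y , unbundled with Y⊆c y∈Y
... | refl = unbundled AB ((id , id) , refl)

module _ {A B : Set} {f : A → B} (f-inj : Injective _≡_ _≡_ f) where

  image-∈⁻ : ∀ {P i} → f i ∈ image f P → i ∈ P
  image-∈⁻ (_ , j∈P , fj≡fi) with refl ← f-inj fj≡fi = j∈P

  image-pair-≢ : ∀ {x y e} → e ∈ image f (｛ x ｝ ∪ ｛ y ｝) → e ≢ f y → f x ≡ e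
  image-pair-≢ (_ , inj₁ refl , fx≡e) _   = fx≡e
  image-pair-≢ (_ , inj₂ refl , fy≡e) e≢fy = ⊥-elim (e≢fy (sym fy≡e))

lemma5p7 : ¬ (Σ GES λ γ → Σ (Fin 3 → GES.Ev γ) λ ι →
                 (∀ i j → ι i ≡ ι j → i ≡ j) ×
                 (∀ (X : EvSet (GES.Ev γ)) →
                    GConf γ X ⇔ Σ (EvSet (Fin 3)) λ Y → BConf βγ Y × (X ≐ image ι Y)))
lemma5p7 (γ , ι , inj , GConf⇔BConf) =
  let Y , conf , c≐ιY = c-only in
  evC-only-not-BConf conf (image-∈⁻ ι-inj (proj₁ c≐ιY refl))
    (λ y∈Y → ι-inj (proj₂ c≐ιY (_ , y∈Y , refl)))
  where
    open GES γ
    ι-inj : Injective _≡_ _≡_ ι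
    ι-inj = inj _ _

    GConf-image : ∀ {Y} → BConf βγ Y → GConf γ (image ι Y)
    GConf-image conf = Equivalence.from (GConf⇔BConf _) (_ , conf , id , id)

    cause-of-c-is : ∀ {x e} → x ∈ AB → e ⟶ ι evC → ¬ ¬ (ι x ≡ e)
    cause-of-c-is x∈AB e⟶c k =
      GConf-cause γ (GConf-image (BConf-·c x∈AB)) (evC , inj₂ refl , refl) e⟶c
        λ (e∈ , e≢c) → k (image-pair-≢ ι-inj e∈ e≢c)

    evA≢evB : evA ≢ evB
    evA≢evB ()

    evC-uncaused : ∀ e → ¬ e ⟶ ι evC
    evC-uncaused e e⟶c =
      cause-of-c-is (inj₁ refl) e⟶c λ ιa≡e →
      cause-of-c-is (inj₂ refl) e⟶c λ ιb≡e →
      evA≢evB (ι-inj (trans ιa≡e (sym ιb≡e)))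

    c-only : Σ (EvSet (Fin 3)) λ Y → BConf βγ Y × (｛ ι evC ｝ ≐ image ι Y)
    c-only = Equivalence.to (GConf⇔BConf _) (GConf-｛｝ γ evC-uncaused)
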